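{- Let $\phi=\frac{1+\sqrt5}{2}$. In the two-heap game described below, where Rebecca moves first and Benny second, if the initial heaps contain $n$ and $k$ tokens with $n/\phi<k<\phi n$, then Benny has a winning strategy.
   Context: The two-heap game: two players, Rebecca and Benny, alternate moves, Rebecca first. A configuration is a pair of non-negative integers $(A,B)$, the numbers of tokens in the two heaps. A move from $(A,B)$ consists of choosing one of the heaps and removing from it a positive number of tokens, at most the size of that heap, that is a multiple of $A$ or a multiple of $B$. The player who takes away the last token wins (equivalently, a player who must move from $(0,0)$ loses). A winning strategy for Benny is a way of choosing his moves guaranteeing that he wins whatever moves Rebecca makes. -}

module Defs where

open import Data.Nat using (ℕ; zero; suc; _+_; _*_; _∸_; _^_; _≤_; _<_)
open import Data.Nat.Divisibility using (_∣_)
open import Data.Product using (_×_; Σ)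
open import Data.Sum using (_⊎_)
open import Relation.Binary.PropositionalEquality using (_≡_)

data Move (A B : ℕ) : ℕ → ℕ → Set where
  fromFirst  : (m A' : ℕ) → 0 < m → A' + m ≡ A → (A ∣ m ⊎ B ∣ m) → Move A B A' B
  fromSecond : (m B' : ℕ) → 0 < m → B' + m ≡ B → (A ∣ m ⊎ B ∣ m) → Move A B A B'

-- Game-theoretic outcome (the game always terminates since the token count
-- strictly decreases):
--   NextWins A B : the player about to move from (A , B) has a winning strategy;
--   PrevWins A B : the player who just moved (i.e. the opponent of the player
--                  to move) has a winning strategy.
data NextWins (A B : ℕ) : Set
data PrevWins (A B : ℕ) : Set

data NextWins A B where
  move : (A' B' : ℕ) → Move A B A' B' → PrevWins A' B' → NextWins A B

data PrevWins A B where
  allMoves : ((A' B' : ℕ) → Move A B A' B' → NextWins A' B') → PrevWins A B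

BennyWins : ℕ → ℕ → Set
BennyWins n k = PrevWins n k

-- k < φ · n, where φ = (1 + √5)/2, expressed in integers:
-- k < φ n  ⇔  2k - n < √5 n  ⇔  (2k ∸ n)² < 5 n²
-- (if 2k < n the left side is 0 and n > 0; otherwise both sides are ≥ 0).
_<φ*_ : ℕ → ℕ → Set
k <φ* n = (2 * k ∸ n) ^ 2 < 5 * n ^ 2

{-# OPTIONS --safe #-}
-- Call a position with heaps a ≤ b golden when b < φ a, i.e. b² < b a + a².
-- From a golden position the larger heap is below 2a, so every move empties a
-- heap or removes exactly a from the larger one; since b < φ a ⇔ φ (b − a) < a,
-- the latter lands on a non-golden position.  From a non-golden position with
-- a > 0, write b = q a + s with s < a: as φ is irrational, exactly one of
-- a < φ s and s + a < φ a holds, so removing a multiple of a reaches the golden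
-- position (s , a) or (a , s + a).  By induction on a + b, golden positions are
-- wins for the second player; the hypothesis of the theorem says that the
-- initial position is golden.
module Submission where

open import Defs
open import Data.Nat using (ℕ; zero; suc; _+_; _*_; _∸_; _≤_; _<_; z<s; _≤?_; _<?_; >-nonZero)
open import Data.Nat.Properties
open import Data.Nat.Divisibility using (_∣_; divides; ∣-refl; ∣⇒≤)
open import Data.Nat.DivMod using (_/_; _%_; m≡m%n+[m/n]*n; m%n<n)
open import Data.Nat.Induction using (<-wellFounded)
open import Data.Nat.Tactic.RingSolver using (solve-∀)
open import Data.Sum using (_⊎_; inj₁; inj₂; [_,_]′)
import Data.Sum as Sum
open import Function.Bundles using (_⇔_; mk⇔; Equivalence)
open import Induction.WellFounded using (Acc; acc)
open import Relation.Binary.Definitions using (tri<; tri≈; tri>)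
open import Relation.Nullary using (¬_; yes; no; contradiction)
open import Relation.Binary.PropositionalEquality

infix 4 _<φ_

_<φ_ : ℕ → ℕ → Set
b <φ a = b * b < b * a + a * a

≮φ0 : ∀ {a} → ¬ a <φ 0
≮φ0 {a} a<φ0 = n≮0 (subst (a * a <_) (cong (_+ 0) (*-zeroʳ a)) a<φ0)

leftover≡0 : ∀ {x m y} → x + m ≡ y → y ≤ m → x ≡ 0
leftover≡0 {zero}      _    _   = refl
leftover≡0 {suc x} {m} refl y≤m = contradiction y≤m (m+n≮n x m)

shift-identity : ∀ s a →
  (s + a) * (s + a) + a * a ≡ ((s + a) * a + a * a) + (a * s + s * s)
shift-identity = solve-∀

+<φ⇔ : ∀ s a → s + a <φ a ⇔ a * s + s * s < a * a
+<φ⇔ s a = mk⇔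
  (λ lt → +-cancelˡ-< Y V U (subst (_< Y + U) (shift-identity s a) (+-monoˡ-< U lt)))
  (λ lt → +-cancelʳ-< U X Y (subst (_< Y + U) (sym (shift-identity s a)) (+-monoʳ-< Y lt)))
  where
  X = (s + a) * (s + a)
  Y = (s + a) * a + a * a
  U = a * a
  V = a * s + s * s

+≡φ⇒≡φ : ∀ s a → (s + a) * (s + a) ≡ (s + a) * a + a * a → a * a ≡ a * s + s * s
+≡φ⇒≡φ s a eq = sym (+-cancelˡ-≡ ((s + a) * a + a * a) _ _ (begin
  ((s + a) * a + a * a) + (a * s + s * s) ≡⟨ shift-identity s a ⟨
  (s + a) * (s + a) + a * a               ≡⟨ cong (_+ a * a) eq ⟩
  ((s + a) * a + a * a) + a * a           ∎))
  where open ≡-Reasoning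

-- Descent: a solution (a , b) with a < b yields the smaller solution (b − a , a).
φ-irrational : ∀ {a b} → 0 < a → b * b ≢ b * a + a * a
φ-irrational {b = b} = descent (<-wellFounded b)
  where
  descent : ∀ {a b} → Acc _<_ b → 0 < a → b * b ≢ b * a + a * a
  descent {a} {b} (acc rec) 0<a eq with a <? b
  ... | yes a<b = descent {b = a} (rec a<b) (m<n⇒0<n∸m a<b) (+≡φ⇒≡φ (b ∸ a) a eq′)
    where
    eq′ : (b ∸ a + a) * (b ∸ a + a) ≡ (b ∸ a + a) * a + a * a
    eq′ = subst (λ x → x * x ≡ x * a + a * a) (sym (m∸n+n≡m (<⇒≤ a<b))) eq
  ... | no a≮b = <-irrefl eq (begin-strict
    b * b         ≤⟨ *-monoʳ-≤ b (≮⇒≥ a≮b) ⟩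
    b * a         <⟨ m<m+n (b * a) (*-mono-< 0<a 0<a) ⟩
    b * a + a * a ∎)
    where open ≤-Reasoning

<φ⊎+<φ : ∀ {a} s → 0 < a → a <φ s ⊎ s + a <φ a
<φ⊎+<φ {a} zero    0<a = inj₂ (m<m+n (a * a) (*-mono-< 0<a 0<a))
<φ⊎+<φ {a} s@(suc _) _ with <-cmp (a * a) (a * s + s * s)
... | tri< lt _ _ = inj₁ lt
... | tri≈ _ eq _ = contradiction eq (φ-irrational {s} {a} z<s)
... | tri> _ _ gt = inj₂ (Equivalence.from (+<φ⇔ s a) gt)

<φ⇒<2* : ∀ {a b} → b <φ a → b < a + a
<φ⇒<2* {a} {b} b<φa with a + a ≤? b
... | no  2a≰b = ≰⇒> 2a≰b
... | yes 2a≤b = contradiction b<φa (≤⇒≯ (begin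
  b * a + a * a ≤⟨ +-monoʳ-≤ (b * a) (*-monoˡ-≤ a (m+n≤o⇒n≤o a 2a≤b)) ⟩
  b * a + b * a ≡⟨ *-distribˡ-+ b a a ⟨
  b * (a + a)   ≤⟨ *-monoʳ-≤ b 2a≤b ⟩
  b * b         ∎))
  where open ≤-Reasoning

multiple<2*⇒≡ : ∀ {a m} → a ∣ m → 0 < m → m < a + a → m ≡ a
multiple<2*⇒≡     (divides 0 refl)             ()  _
multiple<2*⇒≡ {a} (divides 1 refl)             _   _    = +-identityʳ a
multiple<2*⇒≡ {a} (divides (suc (suc j)) refl) _   m<2a =
  contradiction m<2a (≤⇒≯ (+-monoʳ-≤ a (m≤m+n a (j * a))))

move-swap : ∀ {a b a′ b′} → Move a b a′ b′ → Move b a b′ a′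
move-swap (fromFirst  m a′ m>0 eq d) = fromSecond m a′ m>0 eq (Sum.swap d)
move-swap (fromSecond m b′ m>0 eq d) = fromFirst  m b′ m>0 eq (Sum.swap d)

prevWins-swap : ∀ {a b} → PrevWins a b → PrevWins b a
nextWins-swap : ∀ {a b} → NextWins a b → NextWins b a
prevWins-swap (allMoves f)       = allMoves λ a′ b′ mv → nextWins-swap (f b′ a′ (move-swap mv))
nextWins-swap (move a′ b′ mv pw) = move b′ a′ (move-swap mv) (prevWins-swap pw)

no-move-from-00 : ∀ {a′ b′} → ¬ Move 0 0 a′ b′
no-move-from-00 (fromFirst  m a′ m>0 eq _) = n≮0 (subst (0 <_) eq (<-≤-trans m>0 (m≤n+m m a′)))
no-move-from-00 (fromSecond m b′ m>0 eq _) = n≮0 (subst (0 <_) eq (<-≤-trans m>0 (m≤n+m m b′)))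

nextWins-0 : ∀ {b} → 0 < b → NextWins 0 b
nextWins-0 {b} 0<b =
  move 0 0 (fromSecond b 0 0<b refl (inj₂ ∣-refl))
    (allMoves λ _ _ mv → contradiction mv no-move-from-00)

nextWins-removeMultiple : ∀ {a b b′} j → 0 < a → b′ + suc j * a ≡ b → PrevWins a b′ → NextWins a b
nextWins-removeMultiple {a} {b′ = b′} j 0<a eq =
  move a b′ (fromSecond (suc j * a) b′ (<-≤-trans 0<a (m≤m+n a (j * a))) eq
    (inj₁ (divides (suc j) refl)))

prevWins-golden≤ : ∀ {a b} → Acc _<_ (a + b) → a ≤ b → b <φ a → PrevWins a b
nextWins-nonGolden≤ : ∀ {a b} → Acc _<_ (a + b) → 0 < b → a ≤ b → ¬ b <φ a → NextWins a b

prevWins-golden≤ {zero} {b} _ _ b<φ0 = contradiction b<φ0 (≮φ0 {b})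
prevWins-golden≤ {a@(suc _)} {b} (acc rec) a≤b b<φa = allMoves reply
  where
  reply : ∀ a′ b′ → Move a b a′ b′ → NextWins a′ b′
  reply a′ _ (fromFirst m _ m>0 a′+m≡a a∣m⊎b∣m) =
    subst (λ x → NextWins x b) (sym (leftover≡0 a′+m≡a a≤m)) (nextWins-0 (<-≤-trans z<s a≤b))
    where
    instance _ = >-nonZero m>0
    a≤m : a ≤ m
    a≤m = [ ∣⇒≤ , (λ b∣m → ≤-trans a≤b (∣⇒≤ b∣m)) ]′ a∣m⊎b∣m
  reply _ b′ (fromSecond m _ m>0 b′+m≡b (inj₂ b∣m)) =
    subst (NextWins a) (sym (leftover≡0 b′+m≡b (∣⇒≤ {{>-nonZero m>0}} b∣m)))
      (nextWins-swap (nextWins-0 z<s))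
  reply _ b′ (fromSecond m _ m>0 b′+m≡b (inj₁ a∣m)) =
    nextWins-swap (nextWins-nonGolden≤ (rec b′+a<a+b) z<s (<⇒≤ b′<a) a≮φb′)
    where
    b<2a : b < a + a
    b<2a = <φ⇒<2* b<φa
    b′+a≡b : b′ + a ≡ b
    b′+a≡b = subst (λ x → b′ + x ≡ b)
      (multiple<2*⇒≡ a∣m m>0 (≤-<-trans (subst (m ≤_) b′+m≡b (m≤n+m m b′)) b<2a)) b′+m≡b
    b′<a : b′ < a
    b′<a = +-cancelʳ-< a b′ a (subst (_< a + a) (sym b′+a≡b) b<2a)
    a≮φb′ : ¬ a <φ b′
    a≮φb′ = <-asym (Equivalence.to (+<φ⇔ b′ a) (subst (_<φ a) (sym b′+a≡b) b<φa))
    b′+a<a+b : b′ + a < a + b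
    b′+a<a+b = subst (_< a + b) (sym b′+a≡b) (m<n+m b z<s)

nextWins-nonGolden≤ {zero} _ 0<b _ _ = nextWins-0 0<b
nextWins-nonGolden≤ {a@(suc _)} {b} (acc rec) _ a≤b b≮φa =
  respond (b / a) (m≡m%n+[m/n]*n b a) (<φ⊎+<φ (b % a) z<s)
  where
  s = b % a
  s<a : s < a
  s<a = m%n<n b a
  respond : ∀ q → b ≡ s + q * a → a <φ s ⊎ s + a <φ a → NextWins a b
  respond zero b≡s+0 _ = contradiction (subst (a ≤_) (trans b≡s+0 (+-identityʳ s)) a≤b) (<⇒≱ s<a)
  respond (suc q) b≡ (inj₁ a<φs) =
    nextWins-removeMultiple q z<s (sym b≡)
      (prevWins-swap (prevWins-golden≤ (rec s+a<a+b) (<⇒≤ s<a) a<φs))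
    where
    s+a<a+b : s + a < a + b
    s+a<a+b = subst (s + a <_) (+-comm b a) (+-monoˡ-< a (<-≤-trans s<a a≤b))
  respond (suc zero) b≡s+a+0 (inj₂ s+a<φa) =
    contradiction (subst (_<φ a) (sym (trans b≡s+a+0 (cong (s +_) (+-identityʳ a)))) s+a<φa) b≮φa
  respond (suc (suc q)) b≡ (inj₂ s+a<φa) =
    nextWins-removeMultiple q z<s s+a+[1+q]a≡b
      (prevWins-golden≤ (rec a+[s+a]<a+b) (m≤n+m a s) s+a<φa)
    where
    s+a+[1+q]a≡b : (s + a) + suc q * a ≡ b
    s+a+[1+q]a≡b = trans (+-assoc s a (suc q * a)) (sym b≡)
    a+[s+a]<a+b : a + (s + a) < a + b
    a+[s+a]<a+b = +-monoʳ-< a (subst (s + a <_) s+a+[1+q]a≡b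
      (m<m+n (s + a) (<-≤-trans z<s (m≤m+n a (q * a)))))

prevWins-golden : ∀ {a b} → a <φ b → b <φ a → PrevWins a b
prevWins-golden {a} {b} a<φb b<φa with ≤-total a b
... | inj₁ a≤b = prevWins-golden≤ (<-wellFounded _) a≤b b<φa
... | inj₂ b≤a = prevWins-swap (prevWins-golden≤ (<-wellFounded _) b≤a a<φb)

-- For 2k ≥ n, with d = 2k − n: 4 (k n + n² − k²) = 5 n² − d².
<φ*⇒<φ : ∀ k n → k <φ* n → k <φ n
<φ*⇒<φ k zero d²<0 = contradiction d²<0 n≮0
<φ*⇒<φ k n@(suc _) d²<5n² with 2 * k ≤? n
... | yes 2k≤n = begin-strict
  k * k         ≤⟨ *-monoʳ-≤ k (m+n≤o⇒m≤o k 2k≤n) ⟩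
  k * n         <⟨ m<m+n (k * n) z<s ⟩
  k * n + n * n ∎
  where open ≤-Reasoning
... | no 2k≰n = *-cancelˡ-< 4 (k * k) (k * n + n * n) (+-cancelʳ-< (5 * (n * n)) _ _ (begin-strict
  4 * (k * k) + 5 * (n * n)                ≡⟨ cong (_+ 5 * (n * n)) (quadruple-square k) ⟩
  2 * k * (2 * k) + 5 * (n * n)            ≡⟨ expansion-at-2k ⟩
  d * d + (2 * n * (2 * k) + 4 * (n * n))  ≡⟨ cong (d * d +_) (quadruple-golden k n) ⟨
  d * d + 4 * (k * n + n * n)              <⟨ +-monoˡ-< (4 * (k * n + n * n)) d*d<5n*n ⟩
  5 * (n * n) + 4 * (k * n + n * n)        ≡⟨ +-comm (5 * (n * n)) _ ⟩
  4 * (k * n + n * n) + 5 * (n * n)        ∎))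
  where
  open ≤-Reasoning
  d = 2 * k ∸ n
  n+d≡2k : n + d ≡ 2 * k
  n+d≡2k = m+[n∸m]≡n (<⇒≤ (≰⇒> 2k≰n))
  d*d<5n*n : d * d < 5 * (n * n)
  d*d<5n*n = subst₂ _<_ (cong (d *_) (*-identityʳ d)) (cong (λ x → 5 * (n * x)) (*-identityʳ n)) d²<5n²
  quadruple-square : ∀ k → 4 * (k * k) ≡ 2 * k * (2 * k)
  quadruple-square = solve-∀
  quadruple-golden : ∀ k n → 4 * (k * n + n * n) ≡ 2 * n * (2 * k) + 4 * (n * n)
  quadruple-golden = solve-∀
  expansion : ∀ n d → (n + d) * (n + d) + 5 * (n * n) ≡ d * d + (2 * n * (n + d) + 4 * (n * n))
  expansion = solve-∀
  expansion-at-2k : 2 * k * (2 * k) + 5 * (n * n) ≡ d * d + (2 * n * (2 * k) + 4 * (n * n))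
  expansion-at-2k = subst (λ t → t * t + 5 * (n * n) ≡ d * d + (2 * n * t + 4 * (n * n))) n+d≡2k (expansion n d)

corollary1 : (n k : ℕ) → n <φ* k → k <φ* n → BennyWins n k
corollary1 n k n<φk k<φn = prevWins-golden (<φ*⇒<φ n k n<φk) (<φ*⇒<φ k n k<φn)
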